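{- Let $L$ be a finite trim lattice and let $G$ be a group acting on $L$ by lattice automorphisms. Then $L^G=\{x\in L: gx=x\text{ for all }g\in G\}$, which is a sublattice of $L$, is a trim lattice.
   Context: All lattices are finite. An element $x$ of a lattice $L$ is left modular if for all $y<z$ in $L$, $(y\vee x)\wedge z=y\vee(x\wedge z)$. A join-irreducible is an element that is not the minimum $\hat0$ and cannot be written as the join of two strictly smaller elements; a meet-irreducible is an element that is not the maximum $\hat1$ and cannot be written as the meet of two strictly larger elements. A lattice is trim if, for some $n$, it has a maximal chain of $n+1$ left modular elements and has exactly $n$ join-irreducibles and exactly $n$ meet-irreducibles. -}

module Defs where

open import Level using (Level; _⊔_)
open import Data.Nat using (ℕ; zero; suc)
open import Data.Fin using (Fin) renaming (_<_ to _<ᶠ_)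
open import Data.Product using (Σ; Σ-syntax; ∃; ∃-syntax; _×_; _,_; proj₁; proj₂)
open import Data.Sum using (_⊎_)
open import Data.Unit using (⊤)
open import Relation.Nullary using (¬_)
open import Relation.Binary.PropositionalEquality using (_≡_)
open import Relation.Binary.Lattice using (Lattice; IsLattice)
open import Algebra.Bundles using (Group)
import Relation.Binary.Lattice.Properties.JoinSemilattice as JP
import Relation.Binary.Lattice.Properties.MeetSemilattice as MP

module LatticeNotions {c ℓ₁ ℓ₂ : Level} (L : Lattice c ℓ₁ ℓ₂) where
  open Lattice L

  _<_ : Carrier → Carrier → Set (ℓ₁ ⊔ ℓ₂)
  x < y = x ≤ y × ¬ (x ≈ y)

  HasExactly : ∀ {p} → (Carrier → Set p) → ℕ → Set (c ⊔ ℓ₁ ⊔ p)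
  HasExactly P k =
    Σ[ f ∈ (Fin k → Carrier) ]
      ((∀ i j → f i ≈ f j → i ≡ j)
      × (∀ i → P (f i))
      × (∀ x → P x → ∃[ i ] (x ≈ f i)))

  Finite : Set (c ⊔ ℓ₁)
  Finite = ∃[ n ] HasExactly (λ _ → ⊤) n

  IsMinimum : Carrier → Set (c ⊔ ℓ₂)
  IsMinimum x = ∀ y → x ≤ y

  IsMaximum : Carrier → Set (c ⊔ ℓ₂)
  IsMaximum x = ∀ y → y ≤ x

  JoinIrreducible : Carrier → Set (c ⊔ ℓ₁ ⊔ ℓ₂)
  JoinIrreducible x =
    ¬ IsMinimum x × ¬ (Σ[ y ∈ Carrier ] Σ[ z ∈ Carrier ] (y < x × z < x × x ≈ y ∨ z))

  MeetIrreducible : Carrier → Set (c ⊔ ℓ₁ ⊔ ℓ₂)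
  MeetIrreducible x =
    ¬ IsMaximum x × ¬ (Σ[ y ∈ Carrier ] Σ[ z ∈ Carrier ] (x < y × x < z × x ≈ y ∧ z))

  LeftModular : Carrier → Set (c ⊔ ℓ₁ ⊔ ℓ₂)
  LeftModular x = ∀ y z → y < z → ((y ∨ x) ∧ z) ≈ (y ∨ (x ∧ z))

  IsChain : ∀ {n} → (Fin n → Carrier) → Set (ℓ₁ ⊔ ℓ₂)
  IsChain ch = ∀ i j → i <ᶠ j → ch i < ch j

  IsMaximalChain : ∀ {n} → (Fin n → Carrier) → Set (c ⊔ ℓ₁ ⊔ ℓ₂)
  IsMaximalChain ch =
    IsChain ch × (∀ x → (∀ i → x ≤ ch i ⊎ ch i ≤ x) → ∃[ i ] (x ≈ ch i))

  Trim : Set (c ⊔ ℓ₁ ⊔ ℓ₂)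
  Trim =
    ∃[ n ] ( (Σ[ ch ∈ (Fin (suc n) → Carrier) ]
               (IsMaximalChain ch × (∀ i → LeftModular (ch i))))
           × HasExactly JoinIrreducible n
           × HasExactly MeetIrreducible n )

  FiniteTrim : Set (c ⊔ ℓ₁ ⊔ ℓ₂)
  FiniteTrim = Finite × Trim

record ActionByAutomorphisms {g ℓg c ℓ₁ ℓ₂ : Level}
         (G : Group g ℓg) (L : Lattice c ℓ₁ ℓ₂)
         : Set (g ⊔ ℓg ⊔ c ⊔ ℓ₁ ⊔ ℓ₂) where
  private
    module G = Group G
    module L = Lattice L
  field
    act      : G.Carrier → L.Carrier → L.Carrier
    act-cong : ∀ {g h x y} → g G.≈ h → x L.≈ y → act g x L.≈ act h y
    act-ε    : ∀ x → act G.ε x L.≈ x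
    act-∙    : ∀ g h x → act (g G.∙ h) x L.≈ act g (act h x)
    act-∨    : ∀ g x y → act g (x L.∨ y) L.≈ (act g x L.∨ act g y)
    act-∧    : ∀ g x y → act g (x L.∧ y) L.≈ (act g x L.∧ act g y)

module _ {g ℓg c ℓ₁ ℓ₂ : Level} {G : Group g ℓg} {L : Lattice c ℓ₁ ℓ₂}
         (α : ActionByAutomorphisms G L) where
  open Lattice L
  open ActionByAutomorphisms α
  open JP joinSemilattice using (∨-cong)
  open MP meetSemilattice using (∧-cong)

  Fixed : Carrier → Set (g ⊔ ℓ₁)
  Fixed x = ∀ h → act h x ≈ x

  FixedLattice : Lattice (c ⊔ g ⊔ ℓ₁) ℓ₁ ℓ₂
  FixedLattice = record
    { Carrier   = Σ Carrier Fixed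
    ; _≈_       = λ x y → proj₁ x ≈ proj₁ y
    ; _≤_       = λ x y → proj₁ x ≤ proj₁ y
    ; _∨_       = λ x y → (proj₁ x ∨ proj₁ y) ,
                    (λ h → Eq.trans (act-∨ h _ _) (∨-cong (proj₂ x h) (proj₂ y h)))
    ; _∧_       = λ x y → (proj₁ x ∧ proj₁ y) ,
                    (λ h → Eq.trans (act-∧ h _ _) (∧-cong (proj₂ x h) (proj₂ y h)))
    ; isLattice = record
      { isPartialOrder = record
        { isPreorder = record
          { isEquivalence = record
            { refl = Eq.refl ; sym = Eq.sym ; trans = Eq.trans }
          ; reflexive = reflexive
          ; trans = trans
          }
        ; antisym = antisym
        }
      ; supremum = λ x y → let (p , q , r) = supremum (proj₁ x) (proj₁ y)
                           in p , q , (λ z → r (proj₁ z))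
      ; infimum  = λ x y → let (p , q , r) = infimum (proj₁ x) (proj₁ y)
                           in p , q , (λ z → r (proj₁ z))
      }
    }

{-# OPTIONS --safe #-}

-- Let x₀ < ⋯ < xₙ be the left modular maximal chain of L. Each step xₛ < xₛ₊₁ is entered by a
-- join-irreducible jₛ (jₛ ≤ xₛ₊₁, jₛ ≰ xₛ) and left by a meet-irreducible mₛ (xₛ ≤ mₛ,
-- xₛ₊₁ ≰ mₛ); since L has only n of each, jₛ and mₛ are unique. An element a is then left
-- modular iff jₛ ≤ a or a ≤ mₛ for every s, a condition preserved by automorphisms and by
-- joins, so the orbit joins yᵢ = ⋁_g g·xᵢ are fixed and left modular. Their distinct values
-- form a maximal chain of L^G, and at each strict step yₛ < yₛ₊₁ the orbit join of jₛ is the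
-- only fixed join-irreducible entering and the orbit meet of mₛ the only fixed
-- meet-irreducible leaving, which makes L^G trim.

module Submission where

open import Defs
open import Level using (0ℓ; _⊔_)
open import Relation.Binary.Lattice using (Lattice)
open import Algebra.Bundles using (Group)
open import Axiom.ExcludedMiddle using (ExcludedMiddle)

open import Axiom.DoubleNegationElimination using (em⇒dne)
open import Data.Bool.Properties using (T-≡)
open import Data.Empty using (⊥-elim)
open import Data.Fin as Fin using (Fin; zero; suc; toℕ; inject₁; fromℕ)
import Data.Fin.Properties as Finₚ
open import Data.Fin.Subset using (Subset; _∈_; _⊂_)
open import Data.Fin.Induction using (<-weakInduction)
open import Data.Fin.Subset.Induction using (⊂-wellFounded)
open import Data.Nat as ℕ using (ℕ)
import Data.Nat.Properties as ℕₚ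
open import Data.Product using (Σ-syntax; ∃; ∃-syntax; _×_; _,_; proj₁; proj₂)
open import Data.Sum as Sum using (_⊎_; inj₁; inj₂)
open import Data.Unit using (⊤; tt)
open import Data.Vec using (tabulate)
open import Data.Vec.Properties using (lookup∘tabulate; []=⇒lookup; lookup⇒[]=)
import Data.Vec.Functional as Vector
open import Function using (_∘_; Equivalence)
open import Induction.WellFounded using (WellFounded; WfRec; module All; module Subrelation)
import Relation.Binary.Construct.On as On
open import Relation.Binary.Definitions using (tri<; tri≈; tri>)
open import Relation.Binary.Lattice.Properties.Lattice using (∧-∨-lattice)
import Relation.Binary.Lattice.Properties.JoinSemilattice as JoinSemilatticeₚ
import Relation.Binary.Lattice.Properties.MeetSemilattice as MeetSemilatticeₚ
import Relation.Binary.Properties.Poset as Posetₚ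
import Relation.Binary.Reasoning.PartialOrder as ≤-Reasoning
import Relation.Binary.Reasoning.Setoid as ≈-Reasoning
open import Relation.Binary.PropositionalEquality as ≡ using (_≡_)
open import Relation.Nullary using (¬_; yes; no)
open import Relation.Nullary.Decidable using (⌊_⌋; toWitness; fromWitness)

module Classical (em : ExcludedMiddle 0ℓ) where

  dne : {P : Set} → ¬ ¬ P → P
  dne = em⇒dne em

  crossing : ∀ {n} (P : Fin (ℕ.suc n) → Set) → ¬ P zero → P (fromℕ n) →
             ∃[ s ] (¬ P (inject₁ s) × P (suc s))
  crossing {ℕ.zero}  P ¬P₀ Pₙ = ⊥-elim (¬P₀ Pₙ)
  crossing {ℕ.suc n} P ¬P₀ Pₙ with em {P (suc zero)}
  ... | yes P₁ = zero , ¬P₀ , P₁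
  ... | no ¬P₁ = let s , ¬Pₛ , Pₛ₊₁ = crossing (P ∘ suc) ¬P₁ Pₙ in suc s , ¬Pₛ , Pₛ₊₁

  record IncreasingEnumeration {m} (P : Fin m → Set) : Set where
    field
      size       : ℕ
      index      : Fin size → Fin m
      satisfies  : ∀ r → P (index r)
      complete   : ∀ s → P s → ∃[ r ] (index r ≡ s)
      increasing : ∀ {r r′} → r Fin.< r′ → index r Fin.< index r′

    index-injective : ∀ {r r′} → index r ≡ index r′ → r ≡ r′
    index-injective {r} {r′} eq with Finₚ.<-cmp r r′
    ... | tri< r<r′ _ _ = ⊥-elim (Finₚ.<⇒≢ (increasing r<r′) eq)
    ... | tri≈ _ r≡r′ _ = r≡r′
    ... | tri> _ _ r′<r = ⊥-elim (Finₚ.<⇒≢ (increasing r′<r) (≡.sym eq))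

  enumerate : ∀ {m} (P : Fin m → Set) → IncreasingEnumeration P
  enumerate {ℕ.zero} P = record
    { size = 0 ; index = λ () ; satisfies = λ () ; complete = λ () ; increasing = λ { {()} } }
  enumerate {ℕ.suc m} P with enumerate (P ∘ suc) | em {P zero}
  ... | E | no ¬P₀ = record
    { size       = size
    ; index      = suc ∘ index
    ; satisfies  = satisfies
    ; complete   = complete′
    ; increasing = ℕ.s<s ∘ increasing
    }
    where
      open IncreasingEnumeration E
      complete′ : ∀ s → P s → ∃[ r ] (suc (index r) ≡ s)
      complete′ zero    P₀ = ⊥-elim (¬P₀ P₀)
      complete′ (suc s) Pₛ = let r , eq = complete s Pₛ in r , ≡.cong suc eq
  ... | E | yes P₀ = record
    { size       = ℕ.suc size
    ; index      = index′
    ; satisfies  = satisfies′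
    ; complete   = complete′
    ; increasing = increasing′
    }
    where
      open IncreasingEnumeration E
      index′ : Fin (ℕ.suc size) → Fin (ℕ.suc m)
      index′ zero    = zero
      index′ (suc r) = suc (index r)
      satisfies′ : ∀ r → P (index′ r)
      satisfies′ zero    = P₀
      satisfies′ (suc r) = satisfies r
      complete′ : ∀ s → P s → ∃[ r ] (index′ r ≡ s)
      complete′ zero    _  = zero , ≡.refl
      complete′ (suc s) Pₛ = let r , eq = complete s Pₛ in suc r , ≡.cong suc eq
      increasing′ : ∀ {r r′} → r Fin.< r′ → index′ r Fin.< index′ r′
      increasing′ {zero}  {suc r′} _    = ℕ.z<s
      increasing′ {suc r} {suc r′} r<r′ = ℕ.s<s (increasing (ℕ.s<s⁻¹ r<r′))

module Enumeration {c ℓ₁ ℓ₂} (L : Lattice c ℓ₁ ℓ₂) (fin : LatticeNotions.Finite L) where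
  open Lattice L

  N : ℕ
  N = proj₁ fin

  e : Fin N → Carrier
  e = proj₁ (proj₂ fin)

  e-injective : ∀ i j → e i ≈ e j → i ≡ j
  e-injective = proj₁ (proj₂ (proj₂ fin))

  e-onto : ∀ x → ∃[ i ] (x ≈ e i)
  e-onto x = proj₂ (proj₂ (proj₂ (proj₂ fin))) x tt

module JoinSide {c ℓ₁ ℓ₂} (L : Lattice c ℓ₁ ℓ₂) where
  open Lattice L
  open LatticeNotions L

  ⋁ : ∀ {k} → Carrier → (Fin k → Carrier) → Carrier
  ⋁ x f = Vector.foldr _∨_ x f

  ⋁-upper : ∀ {k} x (f : Fin k → Carrier) i → f i ≤ ⋁ x f
  ⋁-upper x f zero    = x≤x∨y _ _
  ⋁-upper x f (suc i) = trans (⋁-upper x (f ∘ suc) i) (y≤x∨y _ _)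

  ⋁-least : ∀ {k x w} (f : Fin k → Carrier) → x ≤ w → (∀ i → f i ≤ w) → ⋁ x f ≤ w
  ⋁-least {ℕ.zero}  f x≤w f≤w = x≤w
  ⋁-least {ℕ.suc k} f x≤w f≤w = ∨-least (f≤w zero) (⋁-least (f ∘ suc) x≤w (f≤w ∘ suc))

  IsSupremum : ∀ {i} {I : Set i} → (I → Carrier) → Carrier → Set (i ⊔ ℓ₂ ⊔ c)
  IsSupremum f u = (∀ i → f i ≤ u) × (∀ w → (∀ i → f i ≤ w) → u ≤ w)

  joinIrreducible-intro : ∀ {p} b → ¬ p ≤ b → (∀ {a} → a ≤ p → ¬ a ≤ b → p ≤ a) →
                          JoinIrreducible p
  joinIrreducible-intro {p} b p≰b minimal =
    (λ p-min → p≰b (p-min b)) ,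
    λ (a , a′ , a<p , a′<p , p≈a∨a′) →
      ≤b a<p λ a≤b → ≤b a′<p λ a′≤b → p≰b (≤-respˡ-≈ (Eq.sym p≈a∨a′) (∨-least a≤b a′≤b))
    where
      ≤b : ∀ {a} → a < p → ¬ ¬ a ≤ b
      ≤b (a≤p , a≉p) a≰b = a≉p (antisym a≤p (minimal a≤p a≰b))

module LatticeProperties {c ℓ₁ ℓ₂} (L : Lattice c ℓ₁ ℓ₂) where
  open Lattice L
  open LatticeNotions L
  open JoinSide L public
  private
    module Dual  = JoinSide (∧-∨-lattice L)
    module Dualᴺ = LatticeNotions (∧-∨-lattice L)

  dual-joinIrreducible : ∀ {x} → Dualᴺ.JoinIrreducible x → MeetIrreducible x
  dual-joinIrreducible (x-not-max , x-indecomposable) =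
    x-not-max ,
    λ (a , b , (x≤a , x≉a) , (x≤b , x≉b) , x≈a∧b) →
      x-indecomposable (a , b , (x≤a , x≉a ∘ Eq.sym) , (x≤b , x≉b ∘ Eq.sym) , x≈a∧b)

  meetIrreducible-intro : ∀ {q} b → ¬ b ≤ q → (∀ {a} → q ≤ a → ¬ b ≤ a → a ≤ q) →
                          MeetIrreducible q
  meetIrreducible-intro b b≰q maximal =
    dual-joinIrreducible (Dual.joinIrreducible-intro b b≰q maximal)

module ClassicalLatticeProperties (em : ExcludedMiddle 0ℓ) (L : Lattice 0ℓ 0ℓ 0ℓ) where
  open Lattice L
  open LatticeNotions L
  open Classical em
  open JoinSemilatticeₚ joinSemilattice using (∨-comm; x≤y⇒x∨y≈y)

  exhaustive : ∀ {P : Carrier → Set} {n} → HasExactly P n →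
               (f : Fin n → Carrier) → (∀ i j → f i ≈ f j → i ≡ j) → (∀ i → P (f i)) →
               ∀ {x} → P x → ∃[ i ] (x ≈ f i)
  exhaustive {P} {n} (g , _ , _ , g-onto) f f-injective f-P {x} Px = dne λ x∉f →
    let a , b , a<b , same = Finₚ.pigeonhole (ℕₚ.n<1+n n) code in collision x∉f a<b same
    where
      element : Fin (ℕ.suc n) → Carrier
      element zero    = x
      element (suc i) = f i
      element-P : ∀ a → P (element a)
      element-P zero    = Px
      element-P (suc i) = f-P i
      code : Fin (ℕ.suc n) → Fin n
      code a = proj₁ (g-onto (element a) (element-P a))
      same-code : ∀ a b → code a ≡ code b → element a ≈ element b
      same-code a b eq = Eq.trans (proj₂ (g-onto _ (element-P a)))
        (Eq.trans (Eq.reflexive (≡.cong g eq)) (Eq.sym (proj₂ (g-onto _ (element-P b)))))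
      collision : ¬ (∃[ i ] (x ≈ f i)) → ∀ {a b} → a Fin.< b → ¬ code a ≡ code b
      collision x∉f {zero}  {suc j} _   eq = x∉f (j , same-code zero (suc j) eq)
      collision x∉f {suc i} {suc j} i<j eq =
        Finₚ.<⇒≢ i<j (≡.cong suc (f-injective i j (same-code (suc i) (suc j) eq)))

  leftModular-joinIrreducible : ∀ {b p v} → LeftModular b → p ≤ v → v ≤ b ∨ p → ¬ v ≤ b →
                                JoinIrreducible v → v ≈ p
  leftModular-joinIrreducible {b} {p} {v} b-lm p≤v v≤b∨p v≰b (_ , v-indecomposable) =
    dne λ v≉p → v-indecomposable
      (p , b ∧ v , (p≤v , v≉p ∘ Eq.sym) ,
       (x∧y≤y b v , λ b∧v≈v → v≰b (≤-respˡ-≈ b∧v≈v (x∧y≤x b v))) ,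
       Eq.trans v≈[p∨b]∧v (b-lm p v (p≤v , v≉p ∘ Eq.sym)))
    where
      v≈[p∨b]∧v : v ≈ (p ∨ b) ∧ v
      v≈[p∨b]∧v = antisym (∧-greatest (≤-respʳ-≈ (∨-comm b p) v≤b∨p) refl) (x∧y≤y _ _)

  leftModular-meetIrreducible : ∀ {b q v} → LeftModular b → v ≤ q → b ∧ q ≤ v → ¬ b ≤ v →
                                MeetIrreducible v → v ≈ q
  leftModular-meetIrreducible {b} {q} {v} b-lm v≤q b∧q≤v b≰v (_ , v-indecomposable) =
    dne λ v≉q → v-indecomposable
      (v ∨ b , q , (x≤x∨y v b , λ v≈v∨b → b≰v (≤-respʳ-≈ (Eq.sym v≈v∨b) (y≤x∨y v b))) ,
       (v≤q , v≉q) ,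
       Eq.sym (Eq.trans (b-lm v q (v≤q , v≉q)) v∨[b∧q]≈v))
    where
      v∨[b∧q]≈v : v ∨ (b ∧ q) ≈ v
      v∨[b∧q]≈v = Eq.trans (∨-comm v (b ∧ q)) (x≤y⇒x∨y≈y b∧q≤v)

module FiniteJoinSide (em : ExcludedMiddle 0ℓ) (L : Lattice 0ℓ 0ℓ 0ℓ)
                      (fin : LatticeNotions.Finite L) where
  open Lattice L
  open LatticeNotions L
  open Classical em
  open JoinSide L
  open Posetₚ poset using (<-trans; <-irrefl; <-respˡ-≈)
  open Enumeration L fin

  ∃-maximum : Carrier → ∃ IsMaximum
  ∃-maximum x =
    ⋁ x e , λ v → let i , v≈eᵢ = e-onto v in ≤-respˡ-≈ (Eq.sym v≈eᵢ) (⋁-upper x e i)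

  private
    strictlyBelow : Carrier → Subset N
    strictlyBelow v = tabulate (λ i → ⌊ em {e i < v} ⌋)

    strictlyBelow⁺ : ∀ {i v} → e i < v → i ∈ strictlyBelow v
    strictlyBelow⁺ {i} eᵢ<v =
      lookup⇒[]= i _ (≡.trans (lookup∘tabulate _ i) (Equivalence.to T-≡ (fromWitness eᵢ<v)))

    strictlyBelow⁻ : ∀ {i v} → i ∈ strictlyBelow v → e i < v
    strictlyBelow⁻ {i} i∈ =
      toWitness (Equivalence.from T-≡ (≡.trans (≡.sym (lookup∘tabulate _ i)) ([]=⇒lookup i∈)))

    strictlyBelow-⊂ : ∀ {a v} → a < v → strictlyBelow a ⊂ strictlyBelow v
    strictlyBelow-⊂ {a} a<v =
      let i , a≈eᵢ = e-onto a
      in (λ j∈ → strictlyBelow⁺ (<-trans (strictlyBelow⁻ j∈) a<v)) ,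
         i , strictlyBelow⁺ (<-respˡ-≈ a≈eᵢ a<v) , λ i∈ → <-irrefl (Eq.sym a≈eᵢ) (strictlyBelow⁻ i∈)

  <-wellFounded : WellFounded _<_
  <-wellFounded =
    Subrelation.wellFounded strictlyBelow-⊂ (On.wellFounded strictlyBelow ⊂-wellFounded)

  joinIrreducible-separates : ∀ {v w} → ¬ v ≤ w → ∃[ j ] (JoinIrreducible j × j ≤ v × ¬ j ≤ w)
  joinIrreducible-separates {v} {w} = All.wfRec <-wellFounded 0ℓ Separated step v
    where
      Separated : Carrier → Set
      Separated v = ¬ v ≤ w → ∃[ j ] (JoinIrreducible j × j ≤ v × ¬ j ≤ w)

      through : ∀ {a v} → a < v → ∃[ j ] (JoinIrreducible j × j ≤ a × ¬ j ≤ w) →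
                ∃[ j ] (JoinIrreducible j × j ≤ v × ¬ j ≤ w)
      through (a≤v , _) (j , j-ji , j≤a , j≰w) = j , j-ji , trans j≤a a≤v , j≰w

      step : ∀ v → WfRec _<_ Separated v → Separated v
      step v separated v≰w with em {Σ[ a ∈ Carrier ] Σ[ b ∈ Carrier ] (a < v × b < v × v ≈ a ∨ b)}
      ... | no indecomposable = v , ((λ v-min → v≰w (v-min w)) , indecomposable) , refl , v≰w
      ... | yes (a , b , a<v , b<v , v≈a∨b) with em {a ≤ w}
      ...   | no a≰w  = through a<v (separated a<v a≰w)
      ...   | yes a≤w = through b<v (separated b<v λ b≤w →
                          v≰w (≤-respˡ-≈ (Eq.sym v≈a∨b) (∨-least a≤w b≤w)))

module FiniteLattice (em : ExcludedMiddle 0ℓ) (L : Lattice 0ℓ 0ℓ 0ℓ)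
                     (fin : LatticeNotions.Finite L) where
  open Lattice L
  open LatticeNotions L
  open FiniteJoinSide em L fin public
  open LatticeProperties L using (dual-joinIrreducible)
  private
    module Dual = FiniteJoinSide em (∧-∨-lattice L) fin

  ∃-minimum : Carrier → ∃ IsMinimum
  ∃-minimum = Dual.∃-maximum

  meetIrreducible-separates : ∀ {v w} → ¬ w ≤ v → ∃[ m ] (MeetIrreducible m × v ≤ m × ¬ w ≤ m)
  meetIrreducible-separates w≰v =
    let m , m-ji , v≤m , w≰m = Dual.joinIrreducible-separates w≰v
    in m , dual-joinIrreducible m-ji , v≤m , w≰m

module Action {g ℓg c ℓ₁ ℓ₂} {G : Group g ℓg} {L : Lattice c ℓ₁ ℓ₂}
              (α : ActionByAutomorphisms G L) where
  open Lattice L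
  open LatticeNotions L
  open ActionByAutomorphisms α
  open JoinSemilatticeₚ joinSemilattice using (∨-cong; x≤y⇒x∨y≈y)
  open MeetSemilatticeₚ meetSemilattice using (∧-cong)
  open Group G using (_⁻¹; _∙_; ε; inverseˡ; inverseʳ)

  act-≈ : ∀ h {x y} → x ≈ y → act h x ≈ act h y
  act-≈ h = act-cong (Group.refl G)

  act⁻¹-act : ∀ h x → act (h ⁻¹) (act h x) ≈ x
  act⁻¹-act h x = begin
    act (h ⁻¹) (act h x) ≈⟨ act-∙ (h ⁻¹) h x ⟨
    act (h ⁻¹ ∙ h) x     ≈⟨ act-cong (inverseˡ h) Eq.refl ⟩
    act ε x              ≈⟨ act-ε x ⟩
    x                    ∎
    where open ≈-Reasoning setoid

  act-act⁻¹ : ∀ h x → act h (act (h ⁻¹) x) ≈ x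
  act-act⁻¹ h x = begin
    act h (act (h ⁻¹) x) ≈⟨ act-∙ h (h ⁻¹) x ⟨
    act (h ∙ h ⁻¹) x     ≈⟨ act-cong (inverseʳ h) Eq.refl ⟩
    act ε x              ≈⟨ act-ε x ⟩
    x                    ∎
    where open ≈-Reasoning setoid

  act-monotone : ∀ h {x y} → x ≤ y → act h x ≤ act h y
  act-monotone h {x} {y} x≤y =
    ≤-respʳ-≈ (Eq.trans (Eq.sym (act-∨ h x y)) (act-≈ h (x≤y⇒x∨y≈y x≤y))) (x≤x∨y _ _)

  act≤⇒≤act⁻¹ : ∀ h {x y} → act h x ≤ y → x ≤ act (h ⁻¹) y
  act≤⇒≤act⁻¹ h hx≤y = ≤-respˡ-≈ (act⁻¹-act h _) (act-monotone (h ⁻¹) hx≤y)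

  ≤act⁻¹⇒act≤ : ∀ h {x y} → x ≤ act (h ⁻¹) y → act h x ≤ y
  ≤act⁻¹⇒act≤ h x≤h⁻¹y = ≤-respʳ-≈ (act-act⁻¹ h _) (act-monotone h x≤h⁻¹y)

  ≤act⇒act⁻¹≤ : ∀ h {x y} → x ≤ act h y → act (h ⁻¹) x ≤ y
  ≤act⇒act⁻¹≤ h x≤hy = ≤-respʳ-≈ (act⁻¹-act h _) (act-monotone (h ⁻¹) x≤hy)

  act⁻¹≤⇒≤act : ∀ h {x y} → act (h ⁻¹) x ≤ y → x ≤ act h y
  act⁻¹≤⇒≤act h h⁻¹x≤y = ≤-respˡ-≈ (act-act⁻¹ h _) (act-monotone h h⁻¹x≤y)

  act-< : ∀ h {x y} → x < y → act h x < act h y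
  act-< h (x≤y , x≉y) =
    act-monotone h x≤y ,
    λ hx≈hy → x≉y (Eq.trans (Eq.sym (act⁻¹-act h _))
                             (Eq.trans (act-≈ (h ⁻¹) hx≈hy) (act⁻¹-act h _)))

  act-minimum : ∀ h {x} → IsMinimum x → IsMinimum (act h x)
  act-minimum h x-min v = ≤act⁻¹⇒act≤ h (x-min _)

  act-leftModular : ∀ h {x} → LeftModular x → LeftModular (act h x)
  act-leftModular h {x} x-lm y z y<z = begin
    (y ∨ act h x) ∧ z                 ≈⟨ ∧-cong (∨-cong (act-act⁻¹ h y) Eq.refl) (act-act⁻¹ h z) ⟨
    (act h y′ ∨ act h x) ∧ act h z′   ≈⟨ ∧-cong (act-∨ h y′ x) Eq.refl ⟨
    act h (y′ ∨ x) ∧ act h z′         ≈⟨ act-∧ h _ _ ⟨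
    act h ((y′ ∨ x) ∧ z′)             ≈⟨ act-≈ h (x-lm y′ z′ (act-< (h ⁻¹) y<z)) ⟩
    act h (y′ ∨ (x ∧ z′))             ≈⟨ act-∨ h _ _ ⟩
    act h y′ ∨ act h (x ∧ z′)         ≈⟨ ∨-cong (act-act⁻¹ h y) (act-∧ h x z′) ⟩
    y ∨ (act h x ∧ act h z′)          ≈⟨ ∨-cong Eq.refl (∧-cong Eq.refl (act-act⁻¹ h z)) ⟩
    y ∨ (act h x ∧ z)                 ∎
    where
      open ≈-Reasoning setoid
      y′ z′ : Carrier
      y′ = act (h ⁻¹) y
      z′ = act (h ⁻¹) z

  fixed-resp-≈ : ∀ {x y} → x ≈ y → Fixed α x → Fixed α y
  fixed-resp-≈ x≈y x-fixed h = Eq.trans (act-≈ h (Eq.sym x≈y)) (Eq.trans (x-fixed h) x≈y)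

  fixed-∧ : ∀ {x y} → Fixed α x → Fixed α y → Fixed α (x ∧ y)
  fixed-∧ x-fixed y-fixed = proj₂ (Lattice._∧_ (FixedLattice α) (_ , x-fixed) (_ , y-fixed))

  act≤fixed⇒≤ : ∀ {v w} h → Fixed α w → act h v ≤ w → v ≤ w
  act≤fixed⇒≤ h w-fixed hv≤w = ≤-respʳ-≈ (w-fixed (h ⁻¹)) (act≤⇒≤act⁻¹ h hv≤w)

  dualAction : ActionByAutomorphisms G (∧-∨-lattice L)
  dualAction = record
    { act      = act
    ; act-cong = act-cong
    ; act-ε    = act-ε
    ; act-∙    = act-∙
    ; act-∨    = act-∧
    ; act-∧    = act-∨
    }

module OrbitJoin (em : ExcludedMiddle 0ℓ) (L : Lattice 0ℓ 0ℓ 0ℓ) (fin : LatticeNotions.Finite L)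
                 {G : Group 0ℓ 0ℓ} (α : ActionByAutomorphisms G L) where
  open Lattice L
  open JoinSide L
  open Action α
  open ActionByAutomorphisms α
  open Group G using (_⁻¹; _∙_; ε)
  open Enumeration L fin

  private
    InOrbit : Carrier → Carrier → Set
    InOrbit x v = ∃[ h ] (v ≈ act h x)

    -- Padding with x does not change the join of the orbit, which contains x = ε·x.
    orbitMember : Carrier → Fin N → Carrier
    orbitMember x i with em {InOrbit x (e i)}
    ... | yes _ = e i
    ... | no _  = x

    orbitMember-inOrbit : ∀ x i → InOrbit x (orbitMember x i)
    orbitMember-inOrbit x i with em {InOrbit x (e i)}
    ... | yes eᵢ∈ = eᵢ∈
    ... | no _    = ε , Eq.sym (act-ε x)

    orbitMember-≈ : ∀ {x i} → InOrbit x (e i) → orbitMember x i ≈ e i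
    orbitMember-≈ {x} {i} eᵢ∈ with em {InOrbit x (e i)}
    ... | yes _   = Eq.refl
    ... | no eᵢ∉ = ⊥-elim (eᵢ∉ eᵢ∈)

  orbitJoin : Carrier → Carrier
  orbitJoin x = ⋁ x (orbitMember x)

  orbitJoin-isSupremum : ∀ x → IsSupremum (λ h → act h x) (orbitJoin x)
  orbitJoin-isSupremum x = upper , least
    where
      upper : ∀ h → act h x ≤ orbitJoin x
      upper h = let i , hx≈eᵢ = e-onto (act h x) in
        ≤-respˡ-≈ (Eq.sym hx≈eᵢ) (≤-respˡ-≈ (orbitMember-≈ (h , Eq.sym hx≈eᵢ)) (⋁-upper x _ i))
      least : ∀ w → (∀ h → act h x ≤ w) → orbitJoin x ≤ w
      least w orbit≤w = ⋁-least (orbitMember x) (≤-respˡ-≈ (act-ε x) (orbit≤w ε)) λ i →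
        let h , xᵢ≈hx = orbitMember-inOrbit x i in ≤-respˡ-≈ (Eq.sym xᵢ≈hx) (orbit≤w h)

  orbitJoin-upper : ∀ h x → act h x ≤ orbitJoin x
  orbitJoin-upper h x = proj₁ (orbitJoin-isSupremum x) h

  orbitJoin-least : ∀ {x w} → (∀ h → act h x ≤ w) → orbitJoin x ≤ w
  orbitJoin-least = proj₂ (orbitJoin-isSupremum _) _

  x≤orbitJoin : ∀ x → x ≤ orbitJoin x
  x≤orbitJoin x = ≤-respˡ-≈ (act-ε x) (orbitJoin-upper ε x)

  orbitJoin-fixed : ∀ x → Fixed α (orbitJoin x)
  orbitJoin-fixed x h = antisym (≤act⁻¹⇒act≤ h (≤act (h ⁻¹))) (≤act h)
    where
      ≤act : ∀ h → orbitJoin x ≤ act h (orbitJoin x)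
      ≤act h = orbitJoin-least λ g →
        act⁻¹≤⇒≤act h (≤-respˡ-≈ (act-∙ (h ⁻¹) g x) (orbitJoin-upper (h ⁻¹ ∙ g) x))

  orbitJoin-least-fixed : ∀ {x w} → Fixed α w → x ≤ w → orbitJoin x ≤ w
  orbitJoin-least-fixed w-fixed x≤w =
    orbitJoin-least λ h → ≤-respʳ-≈ (w-fixed h) (act-monotone h x≤w)

  orbitJoin-monotone : ∀ {x x′} → x ≤ x′ → orbitJoin x ≤ orbitJoin x′
  orbitJoin-monotone x≤x′ = orbitJoin-least λ h → trans (act-monotone h x≤x′) (orbitJoin-upper h _)

module FiniteAction (em : ExcludedMiddle 0ℓ) (L : Lattice 0ℓ 0ℓ 0ℓ) (fin : LatticeNotions.Finite L)
                    {G : Group 0ℓ 0ℓ} (α : ActionByAutomorphisms G L) where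
  open Lattice L
  open Classical em
  open Action α
  open OrbitJoin em L fin α public
  open OrbitJoin em (∧-∨-lattice L) fin dualAction public using () renaming
    ( orbitJoin             to orbitMeet
    ; x≤orbitJoin           to orbitMeet≤x
    ; orbitJoin-fixed       to orbitMeet-fixed
    ; orbitJoin-least-fixed to orbitMeet-greatest-fixed
    )

  fixedLattice-finite : LatticeNotions.Finite (FixedLattice α)
  fixedLattice-finite =
    size , (λ r → e (index r) , satisfies r) ,
    (λ r r′ eq → index-injective (e-injective _ _ eq)) , (λ _ → tt) , onto
    where
      open Enumeration L fin
      open IncreasingEnumeration (enumerate (Fixed α ∘ e))
      onto : ∀ v → ⊤ → ∃[ r ] (proj₁ v ≈ e (index r))
      onto (v , v-fixed) _ =
        let i , v≈eᵢ = e-onto v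
            r , indexᵣ≡i = complete i (fixed-resp-≈ v≈eᵢ v-fixed)
        in r , Eq.trans v≈eᵢ (Eq.reflexive (≡.cong e (≡.sym indexᵣ≡i)))

module TrimLattice (em : ExcludedMiddle 0ℓ) (L : Lattice 0ℓ 0ℓ 0ℓ) (fin : LatticeNotions.Finite L)
  {n : ℕ} (ch : Fin (ℕ.suc n) → Lattice.Carrier L)
  (ch-maximal : LatticeNotions.IsMaximalChain L ch)
  (ch-leftModular : ∀ i → LatticeNotions.LeftModular L (ch i))
  (#joinIrreducibles : LatticeNotions.HasExactly L (LatticeNotions.JoinIrreducible L) n)
  (#meetIrreducibles : LatticeNotions.HasExactly L (LatticeNotions.MeetIrreducible L) n) where
  open Lattice L
  open LatticeNotions L
  open Classical em
  open LatticeProperties L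
  open ClassicalLatticeProperties em L
  open FiniteLattice em L fin
  open JoinSemilatticeₚ joinSemilattice using (∨-monotonic)
  open Posetₚ poset using (<⇒≱)

  ch-monotone : ∀ {i j} → i Fin.≤ j → ch i ≤ ch j
  ch-monotone i≤j with ℕₚ.m≤n⇒m<n∨m≡n i≤j
  ... | inj₁ i<j = proj₁ (proj₁ ch-maximal _ _ i<j)
  ... | inj₂ i≡j = reflexive (Eq.reflexive (≡.cong ch (Finₚ.toℕ-injective i≡j)))

  ch-zero-minimum : IsMinimum (ch zero)
  ch-zero-minimum v =
    let b , b-min = ∃-minimum (ch zero)
        i , b≈chᵢ = proj₂ ch-maximal b (λ i → inj₁ (b-min (ch i)))
    in trans (ch-monotone {zero} {i} ℕ.z≤n) (≤-respˡ-≈ b≈chᵢ (b-min v))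

  ch-last-maximum : IsMaximum (ch (fromℕ n))
  ch-last-maximum v =
    let t , t-max = ∃-maximum (ch zero)
        i , t≈chᵢ = proj₂ ch-maximal t (λ i → inj₂ (t-max (ch i)))
    in trans (≤-respʳ-≈ t≈chᵢ (t-max v)) (ch-monotone (Finₚ.≤fromℕ i))

  below above : Fin n → Carrier
  below s = ch (inject₁ s)
  above s = ch (suc s)

  below<above : ∀ s → below s < above s
  below<above s = proj₁ ch-maximal _ _ (Finₚ.≤̄⇒inject₁< Finₚ.≤-refl)

  above≤below : ∀ {s t} → s Fin.< t → above s ≤ below t
  above≤below {s} {t} s<t =
    ch-monotone (≡.subst (ℕ.suc (toℕ s) ℕ.≤_) (≡.sym (Finₚ.toℕ-inject₁ t)) s<t)

  private
    ≤inject₁⊎suc≤ : ∀ (i : Fin (ℕ.suc n)) (s : Fin n) → i Fin.≤ inject₁ s ⊎ suc s Fin.≤ i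
    ≤inject₁⊎suc≤ i s with toℕ i ℕ.≤? toℕ s
    ... | yes i≤s = inj₁ (≡.subst (toℕ i ℕ.≤_) (≡.sym (Finₚ.toℕ-inject₁ s)) i≤s)
    ... | no i≰s  = inj₂ (ℕₚ.≰⇒> i≰s)

    comparable-between : ∀ {s v} → below s ≤ v → v ≤ above s → ∀ i → v ≤ ch i ⊎ ch i ≤ v
    comparable-between {s} below≤v v≤above i =
      Sum.swap (Sum.map (λ i≤ → trans (ch-monotone i≤) below≤v)
                        (λ ≤i → trans v≤above (ch-monotone ≤i))
                        (≤inject₁⊎suc≤ i s))

  covers : ∀ {s v} → below s ≤ v → v ≤ above s → v ≈ below s ⊎ v ≈ above s
  covers {s} {v} below≤v v≤above =
    let i , v≈chᵢ = proj₂ ch-maximal v (comparable-between below≤v v≤above)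
    in Sum.map (λ i≤ → antisym (≤-respˡ-≈ (Eq.sym v≈chᵢ) (ch-monotone i≤)) below≤v)
               (λ ≤i → antisym v≤above (≤-respʳ-≈ (Eq.sym v≈chᵢ) (ch-monotone ≤i)))
               (≤inject₁⊎suc≤ i s)

  EntersAt : Fin n → Carrier → Set
  EntersAt s j = j ≤ above s × ¬ j ≤ below s

  LeavesAt : Fin n → Carrier → Set
  LeavesAt s m = below s ≤ m × ¬ above s ≤ m

  entersAt-resp-≈ : ∀ {s j j′} → j ≈ j′ → EntersAt s j → EntersAt s j′
  entersAt-resp-≈ j≈j′ (j≤a , j≰b) = ≤-respˡ-≈ j≈j′ j≤a , j≰b ∘ ≤-respˡ-≈ (Eq.sym j≈j′)

  leavesAt-resp-≈ : ∀ {s m m′} → m ≈ m′ → LeavesAt s m → LeavesAt s m′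
  leavesAt-resp-≈ m≈m′ (b≤m , a≰m) = ≤-respʳ-≈ m≈m′ b≤m , a≰m ∘ ≤-respʳ-≈ (Eq.sym m≈m′)

  entersAt-unique : ∀ {s t j} → EntersAt s j → EntersAt t j → s ≡ t
  entersAt-unique {s} {t} (j≤aₛ , j≰bₛ) (j≤aₜ , j≰bₜ) with Finₚ.<-cmp s t
  ... | tri< s<t _ _ = ⊥-elim (j≰bₜ (trans j≤aₛ (above≤below s<t)))
  ... | tri≈ _ s≡t _ = s≡t
  ... | tri> _ _ t<s = ⊥-elim (j≰bₛ (trans j≤aₜ (above≤below t<s)))

  leavesAt-unique : ∀ {s t m} → LeavesAt s m → LeavesAt t m → s ≡ t
  leavesAt-unique {s} {t} (bₛ≤m , aₛ≰m) (bₜ≤m , aₜ≰m) with Finₚ.<-cmp s t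
  ... | tri< s<t _ _ = ⊥-elim (aₛ≰m (trans (above≤below s<t) bₜ≤m))
  ... | tri≈ _ s≡t _ = s≡t
  ... | tri> _ _ t<s = ⊥-elim (aₜ≰m (trans (above≤below t<s) bₛ≤m))

  jAt : Fin n → Carrier
  jAt s = proj₁ (joinIrreducible-separates (<⇒≱ (below<above s)))

  jAt-joinIrreducible : ∀ s → JoinIrreducible (jAt s)
  jAt-joinIrreducible s = proj₁ (proj₂ (joinIrreducible-separates (<⇒≱ (below<above s))))

  jAt-entersAt : ∀ s → EntersAt s (jAt s)
  jAt-entersAt s = proj₂ (proj₂ (joinIrreducible-separates (<⇒≱ (below<above s))))

  mAt : Fin n → Carrier
  mAt s = proj₁ (meetIrreducible-separates (<⇒≱ (below<above s)))

  mAt-meetIrreducible : ∀ s → MeetIrreducible (mAt s)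
  mAt-meetIrreducible s = proj₁ (proj₂ (meetIrreducible-separates (<⇒≱ (below<above s))))

  mAt-leavesAt : ∀ s → LeavesAt s (mAt s)
  mAt-leavesAt s = proj₂ (proj₂ (meetIrreducible-separates (<⇒≱ (below<above s))))

  jAt-injective : ∀ s t → jAt s ≈ jAt t → s ≡ t
  jAt-injective s t jₛ≈jₜ =
    entersAt-unique (jAt-entersAt s) (entersAt-resp-≈ (Eq.sym jₛ≈jₜ) (jAt-entersAt t))

  mAt-injective : ∀ s t → mAt s ≈ mAt t → s ≡ t
  mAt-injective s t mₛ≈mₜ =
    leavesAt-unique (mAt-leavesAt s) (leavesAt-resp-≈ (Eq.sym mₛ≈mₜ) (mAt-leavesAt t))

  -- There are only n join-irreducibles, so the n distinct jAt s are all of them.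
  joinIrreducible≈jAt : ∀ {j} → JoinIrreducible j → ∃[ s ] (j ≈ jAt s)
  joinIrreducible≈jAt = exhaustive #joinIrreducibles jAt jAt-injective jAt-joinIrreducible

  meetIrreducible≈mAt : ∀ {m} → MeetIrreducible m → ∃[ s ] (m ≈ mAt s)
  meetIrreducible≈mAt = exhaustive #meetIrreducibles mAt mAt-injective mAt-meetIrreducible

  jAt-unique : ∀ {s j} → JoinIrreducible j → EntersAt s j → j ≈ jAt s
  jAt-unique j-ji j-entersAt =
    let t , j≈jₜ = joinIrreducible≈jAt j-ji
    in Eq.trans j≈jₜ (Eq.reflexive (≡.cong jAt
         (entersAt-unique (jAt-entersAt t) (entersAt-resp-≈ j≈jₜ j-entersAt))))

  mAt-unique : ∀ {s m} → MeetIrreducible m → LeavesAt s m → m ≈ mAt s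
  mAt-unique m-mi m-leavesAt =
    let t , m≈mₜ = meetIrreducible≈mAt m-mi
    in Eq.trans m≈mₜ (Eq.reflexive (≡.cong mAt
         (leavesAt-unique (mAt-leavesAt t) (leavesAt-resp-≈ m≈mₜ m-leavesAt))))

  jAt-least : ∀ {s v} → v ≤ above s → ¬ v ≤ below s → jAt s ≤ v
  jAt-least v≤a v≰b =
    let j , j-ji , j≤v , j≰b = joinIrreducible-separates v≰b
    in ≤-respˡ-≈ (jAt-unique j-ji (trans j≤v v≤a , j≰b)) j≤v

  mAt-greatest : ∀ {s v} → below s ≤ v → ¬ above s ≤ v → v ≤ mAt s
  mAt-greatest b≤v a≰v =
    let m , m-mi , v≤m , a≰m = meetIrreducible-separates a≰v
    in ≤-respʳ-≈ (mAt-unique m-mi (trans b≤v v≤m , a≰m)) v≤m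

  above≤below∨jAt : ∀ s → above s ≤ below s ∨ jAt s
  above≤below∨jAt s with covers (x≤x∨y (below s) (jAt s))
                                (∨-least (proj₁ (below<above s)) (proj₁ (jAt-entersAt s)))
  ... | inj₁ ≈below = ⊥-elim (proj₂ (jAt-entersAt s) (≤-respʳ-≈ ≈below (y≤x∨y _ _)))
  ... | inj₂ ≈above = reflexive (Eq.sym ≈above)

  jAt≰mAt : ∀ s → ¬ jAt s ≤ mAt s
  jAt≰mAt s jₛ≤mₛ = proj₂ (mAt-leavesAt s)
    (trans (above≤below∨jAt s) (∨-least (proj₁ (mAt-leavesAt s)) jₛ≤mₛ))

  private
    separates-at : ∀ {r t} s → r < t → ¬ t ≤ r ∨ below s → t ≤ r ∨ above s →
                   jAt s ≤ t × ¬ jAt s ≤ r × r ≤ mAt s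
    separates-at {r} {t} s r<t t≰r∨bₛ t≤r∨aₛ = jₛ≤t , jₛ≰r , r≤mₛ
      where
        t≤r∨[aₛ∧t] : t ≤ r ∨ (above s ∧ t)
        t≤r∨[aₛ∧t] = trans (∧-greatest t≤r∨aₛ refl) (reflexive (ch-leftModular (suc s) r t r<t))
        jₛ≤t : jAt s ≤ t
        jₛ≤t = trans (jAt-least (x∧y≤x _ _) λ aₛ∧t≤bₛ →
                        t≰r∨bₛ (trans t≤r∨[aₛ∧t] (∨-monotonic refl aₛ∧t≤bₛ)))
                     (x∧y≤y _ _)
        jₛ≰r : ¬ jAt s ≤ r
        jₛ≰r jₛ≤r = t≰r∨bₛ (trans t≤r∨aₛ (∨-least (x≤x∨y _ _)
          (trans (above≤below∨jAt s) (∨-least (y≤x∨y _ _) (trans jₛ≤r (x≤x∨y _ _))))))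
        r≤mₛ : r ≤ mAt s
        r≤mₛ = trans (x≤x∨y r (below s)) (mAt-greatest (y≤x∨y _ _) λ aₛ≤r∨bₛ →
          t≰r∨bₛ (trans t≤r∨aₛ (∨-least (x≤x∨y _ _) aₛ≤r∨bₛ)))

  ∃-separating-step : ∀ {r t} → r < t → ∃[ s ] (jAt s ≤ t × ¬ jAt s ≤ r × r ≤ mAt s)
  ∃-separating-step {r} {t} r<t =
    let s , t≰r∨bₛ , t≤r∨aₛ = crossing (λ i → t ≤ r ∨ ch i) t≰r∨ch₀
                                         (trans (ch-last-maximum t) (y≤x∨y r _))
    in s , separates-at s r<t t≰r∨bₛ t≤r∨aₛ
    where
      t≰r∨ch₀ : ¬ t ≤ r ∨ ch zero
      t≰r∨ch₀ t≤r∨ch₀ = <⇒≱ r<t (trans t≤r∨ch₀ (∨-least refl (ch-zero-minimum r)))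

  Splits : Carrier → Set
  Splits a = ∀ s → jAt s ≤ a ⊎ a ≤ mAt s

  leftModular⇒splits : ∀ {a} → LeftModular a → Splits a
  leftModular⇒splits {a} a-lm s with em {jAt s ≤ a}
  ... | yes jₛ≤a = inj₁ jₛ≤a
  ... | no jₛ≰a  = inj₂ (trans (y≤x∨y (below s) a) (mAt-greatest (x≤x∨y _ _) aₛ≰bₛ∨a))
    where
      a∧aₛ≤bₛ : a ∧ above s ≤ below s
      a∧aₛ≤bₛ = dne λ a∧aₛ≰bₛ → jₛ≰a (trans (jAt-least (x∧y≤y _ _) a∧aₛ≰bₛ) (x∧y≤x _ _))
      aₛ≰bₛ∨a : ¬ above s ≤ below s ∨ a
      aₛ≰bₛ∨a aₛ≤bₛ∨a = <⇒≱ (below<above s) (trans (∧-greatest aₛ≤bₛ∨a refl)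
        (trans (reflexive (a-lm (below s) (above s) (below<above s))) (∨-least refl a∧aₛ≤bₛ)))

  splits⇒≤mAt : ∀ {a s} → Splits a → ¬ jAt s ≤ a → a ≤ mAt s
  splits⇒≤mAt {s = s} a-splits jₛ≰a with a-splits s
  ... | inj₁ jₛ≤a = ⊥-elim (jₛ≰a jₛ≤a)
  ... | inj₂ a≤mₛ = a≤mₛ

  splits⇒leftModular : ∀ {a} → Splits a → LeftModular a
  splits⇒leftModular {a} a-splits y z y<z = antisym (dne T≤R) R≤T
    where
      R≤T : y ∨ (a ∧ z) ≤ (y ∨ a) ∧ z
      R≤T = ∧-greatest (∨-monotonic refl (x∧y≤x a z)) (∨-least (proj₁ y<z) (x∧y≤y a z))
      T≤R : ¬ ¬ (y ∨ a) ∧ z ≤ y ∨ (a ∧ z)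
      T≤R T≰R =
        let s , jₛ≤T , jₛ≰R , R≤mₛ =
              ∃-separating-step (R≤T , λ R≈T → T≰R (reflexive (Eq.sym R≈T)))
        in
        Sum.[ (λ jₛ≤a → jₛ≰R (trans (∧-greatest jₛ≤a (trans jₛ≤T (x∧y≤y _ _))) (y≤x∨y y (a ∧ z))))
            , (λ a≤mₛ → jAt≰mAt s (trans jₛ≤T (trans (x∧y≤x _ _)
                           (∨-least (trans (x≤x∨y y (a ∧ z)) R≤mₛ) a≤mₛ))))
            ]′ (a-splits s)

  module _ {I : Set} {f : I → Carrier} {u : Carrier}
           (u-sup : IsSupremum f u) (f-splits : ∀ i → Splits (f i)) where

    private
      sup≤mAt : ∀ {s} → (∀ i → ¬ jAt s ≤ f i) → u ≤ mAt s
      sup≤mAt jₛ≰f = proj₂ u-sup _ λ i → splits⇒≤mAt (f-splits i) (jₛ≰f i)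

    sup-splits : Splits u
    sup-splits s with em {jAt s ≤ u}
    ... | yes jₛ≤u = inj₁ jₛ≤u
    ... | no jₛ≰u  = inj₂ (sup≤mAt λ i jₛ≤fᵢ → jₛ≰u (trans jₛ≤fᵢ (proj₁ u-sup i)))

    joinIrreducible-≤-sup : ∀ {j} → JoinIrreducible j → j ≤ u → ∃[ i ] (j ≤ f i)
    joinIrreducible-≤-sup j-ji j≤u =
      let s , j≈jₛ = joinIrreducible≈jAt j-ji
      in dne λ j≰f → jAt≰mAt s (trans (≤-respˡ-≈ j≈jₛ j≤u)
           (sup≤mAt λ i jₛ≤fᵢ → j≰f (i , ≤-respˡ-≈ (Eq.sym j≈jₛ) jₛ≤fᵢ)))

  module FixedPoints {G : Group 0ℓ 0ℓ} (α : ActionByAutomorphisms G L) where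
    open ActionByAutomorphisms α using (act; act-∨)
    open Action α
    open FiniteAction em L fin α
    open Group G using (_⁻¹)
    -- Notions of Lᴳ only inspect first components, so fixedness proofs in implicit
    -- arguments of lemmas about Lᴳ cannot be inferred and are given explicitly.
    private
      module Lᴳ where
        open Lattice (FixedLattice α) public
        open LatticeNotions (FixedLattice α) public
        open LatticeProperties (FixedLattice α) public
        open ClassicalLatticeProperties em (FixedLattice α) public

    chᴳ : Fin (ℕ.suc n) → Carrier
    chᴳ i = orbitJoin (ch i)

    belowᴳ aboveᴳ jᴳ mᴳ : Fin n → Carrier
    belowᴳ s = chᴳ (inject₁ s)
    aboveᴳ s = chᴳ (suc s)
    jᴳ s = orbitJoin (jAt s)
    mᴳ s = orbitMeet (mAt s)

    chᴳ-fixed : ∀ i → Fixed α (chᴳ i)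
    chᴳ-fixed i = orbitJoin-fixed (ch i)

    jᴳ-fixed : ∀ s → Fixed α (jᴳ s)
    jᴳ-fixed s = orbitJoin-fixed (jAt s)

    mᴳ-fixed : ∀ s → Fixed α (mᴳ s)
    mᴳ-fixed s = orbitMeet-fixed (mAt s)

    chᴳ-zero-minimum : IsMinimum (chᴳ zero)
    chᴳ-zero-minimum v = orbitJoin-least λ h → act-minimum h ch-zero-minimum v

    chᴳ-last-maximum : IsMaximum (chᴳ (fromℕ n))
    chᴳ-last-maximum v = trans (ch-last-maximum v) (x≤orbitJoin _)

    orbit-splits : ∀ i h → Splits (act h (ch i))
    orbit-splits i h = leftModular⇒splits (act-leftModular h (ch-leftModular i))

    chᴳ-leftModular : ∀ i → LeftModular (chᴳ i)
    chᴳ-leftModular i =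
      splits⇒leftModular (sup-splits (orbitJoin-isSupremum (ch i)) (orbit-splits i))

    belowᴳ≤aboveᴳ : ∀ s → belowᴳ s ≤ aboveᴳ s
    belowᴳ≤aboveᴳ s = orbitJoin-monotone (proj₁ (below<above s))

    aboveᴳ≤belowᴳ : ∀ {s t} → s Fin.< t → aboveᴳ s ≤ belowᴳ t
    aboveᴳ≤belowᴳ = orbitJoin-monotone ∘ above≤below

    aboveᴳ≤belowᴳ∨jᴳ : ∀ s → aboveᴳ s ≤ belowᴳ s ∨ jᴳ s
    aboveᴳ≤belowᴳ∨jᴳ s = orbitJoin-least λ h →
      trans (act-monotone h (above≤below∨jAt s))
            (≤-respˡ-≈ (Eq.sym (act-∨ h _ _))
                       (∨-monotonic (orbitJoin-upper h (below s)) (orbitJoin-upper h (jAt s))))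

    jᴳ≤aboveᴳ : ∀ s → jᴳ s ≤ aboveᴳ s
    jᴳ≤aboveᴳ s =
      orbitJoin-least-fixed (chᴳ-fixed (suc s)) (trans (proj₁ (jAt-entersAt s)) (x≤orbitJoin _))

    aboveᴳ≰mᴳ : ∀ s → ¬ aboveᴳ s ≤ mᴳ s
    aboveᴳ≰mᴳ s aᴳ≤mᴳ = jAt≰mAt s
      (trans (proj₁ (jAt-entersAt s)) (trans (x≤orbitJoin _) (trans aᴳ≤mᴳ (orbitMeet≤x _))))

    jᴳ-least : ∀ {s w} → Fixed α w → w ≤ aboveᴳ s → ¬ w ≤ belowᴳ s → jᴳ s ≤ w
    jᴳ-least {s} {w} w-fixed w≤aᴳ w≰bᴳ =
      let j , j-ji , j≤w , j≰bᴳ = joinIrreducible-separates w≰bᴳ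
          h , j≤h·aₛ = joinIrreducible-≤-sup (orbitJoin-isSupremum (above s)) (orbit-splits (suc s))
                                              j-ji (trans j≤w w≤aᴳ)
          h⁻¹·j≰bₛ : ¬ act (h ⁻¹) j ≤ below s
          h⁻¹·j≰bₛ h⁻¹·j≤bₛ = j≰bᴳ (trans (act⁻¹≤⇒≤act h h⁻¹·j≤bₛ) (orbitJoin-upper h (below s)))
          h·jₛ≤j : act h (jAt s) ≤ j
          h·jₛ≤j = ≤act⁻¹⇒act≤ h (jAt-least (≤act⇒act⁻¹≤ h j≤h·aₛ) h⁻¹·j≰bₛ)
      in orbitJoin-least-fixed w-fixed (act≤fixed⇒≤ h w-fixed (trans h·jₛ≤j j≤w))

    mᴳ-greatest : ∀ {s w} → Fixed α w → belowᴳ s ≤ w → ¬ aboveᴳ s ≤ w → w ≤ mᴳ s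
    mᴳ-greatest w-fixed bᴳ≤w aᴳ≰w = orbitMeet-greatest-fixed w-fixed
      (mAt-greatest (trans (x≤orbitJoin _) bᴳ≤w)
                    (λ aₛ≤w → aᴳ≰w (orbitJoin-least-fixed w-fixed aₛ≤w)))

    StrictStep : Fin n → Set
    StrictStep s = ¬ aboveᴳ s ≤ belowᴳ s

    belowᴳ<aboveᴳ : ∀ {s} → StrictStep s → belowᴳ s < aboveᴳ s
    belowᴳ<aboveᴳ {s} strict = belowᴳ≤aboveᴳ s , λ bᴳ≈aᴳ → strict (reflexive (Eq.sym bᴳ≈aᴳ))

    jᴳ≰belowᴳ : ∀ {s} → StrictStep s → ¬ jᴳ s ≤ belowᴳ s
    jᴳ≰belowᴳ {s} strict jᴳ≤bᴳ = strict (trans (aboveᴳ≤belowᴳ∨jᴳ s) (∨-least refl jᴳ≤bᴳ))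

    belowᴳ≤mᴳ : ∀ {s} → StrictStep s → belowᴳ s ≤ mᴳ s
    belowᴳ≤mᴳ {s} strict = mᴳ-greatest (chᴳ-fixed (inject₁ s)) refl strict

    aboveᴳ∧mᴳ≤belowᴳ : ∀ {s} → StrictStep s → aboveᴳ s ∧ mᴳ s ≤ belowᴳ s
    aboveᴳ∧mᴳ≤belowᴳ {s} strict = dne λ aᴳ∧mᴳ≰bᴳ → aboveᴳ≰mᴳ s
      (trans (aboveᴳ≤belowᴳ∨jᴳ s) (∨-least (belowᴳ≤mᴳ strict)
        (trans (jᴳ-least (fixed-∧ (chᴳ-fixed (suc s)) (mᴳ-fixed s)) (x∧y≤x _ _) aᴳ∧mᴳ≰bᴳ)
               (x∧y≤y _ _))))

    jᴳ-injective : ∀ {s t} → StrictStep s → StrictStep t → jᴳ s ≈ jᴳ t → s ≡ t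
    jᴳ-injective {s} {t} strictₛ strictₜ jᴳₛ≈jᴳₜ with Finₚ.<-cmp s t
    ... | tri< s<t _ _ = ⊥-elim (jᴳ≰belowᴳ strictₜ
                           (≤-respˡ-≈ jᴳₛ≈jᴳₜ (trans (jᴳ≤aboveᴳ s) (aboveᴳ≤belowᴳ s<t))))
    ... | tri≈ _ s≡t _ = s≡t
    ... | tri> _ _ t<s = ⊥-elim (jᴳ≰belowᴳ strictₛ
                           (≤-respˡ-≈ (Eq.sym jᴳₛ≈jᴳₜ) (trans (jᴳ≤aboveᴳ t) (aboveᴳ≤belowᴳ t<s))))

    mᴳ-injective : ∀ {s t} → StrictStep s → StrictStep t → mᴳ s ≈ mᴳ t → s ≡ t
    mᴳ-injective {s} {t} strictₛ strictₜ mᴳₛ≈mᴳₜ with Finₚ.<-cmp s t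
    ... | tri< s<t _ _ = ⊥-elim (aboveᴳ≰mᴳ s
                           (trans (aboveᴳ≤belowᴳ s<t)
                                  (≤-respʳ-≈ (Eq.sym mᴳₛ≈mᴳₜ) (belowᴳ≤mᴳ strictₜ))))
    ... | tri≈ _ s≡t _ = s≡t
    ... | tri> _ _ t<s = ⊥-elim (aboveᴳ≰mᴳ t
                           (trans (aboveᴳ≤belowᴳ t<s) (≤-respʳ-≈ mᴳₛ≈mᴳₜ (belowᴳ≤mᴳ strictₛ))))

    jᴳ-joinIrreducible : ∀ {s} → StrictStep s → Lᴳ.JoinIrreducible (jᴳ s , jᴳ-fixed s)
    jᴳ-joinIrreducible {s} strict =
      Lᴳ.joinIrreducible-intro {jᴳ s , jᴳ-fixed s} (belowᴳ s , chᴳ-fixed (inject₁ s))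
        (jᴳ≰belowᴳ strict)
        λ {a} a≤jᴳ a≰bᴳ → jᴳ-least (proj₂ a) (trans a≤jᴳ (jᴳ≤aboveᴳ s)) a≰bᴳ

    mᴳ-meetIrreducible : ∀ {s} → StrictStep s → Lᴳ.MeetIrreducible (mᴳ s , mᴳ-fixed s)
    mᴳ-meetIrreducible {s} strict =
      Lᴳ.meetIrreducible-intro {mᴳ s , mᴳ-fixed s} (aboveᴳ s , chᴳ-fixed (suc s)) (aboveᴳ≰mᴳ s)
        λ {a} mᴳ≤a aᴳ≰a → mᴳ-greatest (proj₂ a) (trans (belowᴳ≤mᴳ strict) mᴳ≤a) aᴳ≰a

    chᴳ-leftModularᴳ : ∀ i → Lᴳ.LeftModular (chᴳ i , chᴳ-fixed i)
    chᴳ-leftModularᴳ i y z = chᴳ-leftModular i (proj₁ y) (proj₁ z)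

    joinIrreducibleᴳ-entersAt : ∀ {v} → Lᴳ.JoinIrreducible v →
                                ∃[ s ] (StrictStep s × proj₁ v ≈ jᴳ s)
    joinIrreducibleᴳ-entersAt {v , v-fixed} v-ji =
      let s , v≰bᴳ , v≤aᴳ = crossing (λ i → v ≤ chᴳ i) v≰ch₀ (chᴳ-last-maximum v)
          strict : StrictStep s
          strict aᴳ≤bᴳ = v≰bᴳ (trans v≤aᴳ aᴳ≤bᴳ)
      in s , strict ,
         Lᴳ.leftModular-joinIrreducible
           {chᴳ (inject₁ s) , chᴳ-fixed (inject₁ s)} {jᴳ s , jᴳ-fixed s} {v , v-fixed}
           (chᴳ-leftModularᴳ (inject₁ s)) (jᴳ-least v-fixed v≤aᴳ v≰bᴳ)
           (trans v≤aᴳ (aboveᴳ≤belowᴳ∨jᴳ s)) v≰bᴳ v-ji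
      where
        v≰ch₀ : ¬ v ≤ chᴳ zero
        v≰ch₀ v≤ch₀ = proj₁ v-ji λ w → trans v≤ch₀ (chᴳ-zero-minimum (proj₁ w))

    meetIrreducibleᴳ-leavesAt : ∀ {v} → Lᴳ.MeetIrreducible v →
                                ∃[ s ] (StrictStep s × proj₁ v ≈ mᴳ s)
    meetIrreducibleᴳ-leavesAt {v , v-fixed} v-mi =
      let s , ¬bᴳ≰v , aᴳ≰v = crossing (λ i → ¬ chᴳ i ≤ v) ¬¬ch₀≤v ¬chₙ≤v
          bᴳ≤v : belowᴳ s ≤ v
          bᴳ≤v = dne ¬bᴳ≰v
          strict : StrictStep s
          strict aᴳ≤bᴳ = aᴳ≰v (trans aᴳ≤bᴳ bᴳ≤v)
      in s , strict ,
         Lᴳ.leftModular-meetIrreducible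
           {chᴳ (suc s) , chᴳ-fixed (suc s)} {mᴳ s , mᴳ-fixed s} {v , v-fixed}
           (chᴳ-leftModularᴳ (suc s)) (mᴳ-greatest v-fixed bᴳ≤v aᴳ≰v)
           (trans (aboveᴳ∧mᴳ≤belowᴳ strict) bᴳ≤v) aᴳ≰v v-mi
      where
        ¬¬ch₀≤v : ¬ ¬ chᴳ zero ≤ v
        ¬¬ch₀≤v ch₀≰v = ch₀≰v (chᴳ-zero-minimum v)
        ¬chₙ≤v : ¬ chᴳ (fromℕ n) ≤ v
        ¬chₙ≤v chₙ≤v = proj₁ v-mi λ w → trans (chᴳ-last-maximum (proj₁ w)) chₙ≤v

    open IncreasingEnumeration (enumerate StrictStep)

    position : Fin (ℕ.suc size) → Fin (ℕ.suc n)
    position zero    = zero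
    position (suc r) = suc (index r)

    chainᴳ : Fin (ℕ.suc size) → Lᴳ.Carrier
    chainᴳ r = chᴳ (position r) , chᴳ-fixed (position r)

    chainᴳ-increasing : Lᴳ.IsChain chainᴳ
    chainᴳ-increasing zero (suc r′) _ = begin-strict
      chᴳ zero           ≤⟨ chᴳ-zero-minimum _ ⟩
      belowᴳ (index r′)  <⟨ belowᴳ<aboveᴳ (satisfies r′) ⟩
      aboveᴳ (index r′)  ∎
      where open ≤-Reasoning poset
    chainᴳ-increasing (suc r) (suc r′) r<r′ = begin-strict
      aboveᴳ (index r)   ≤⟨ aboveᴳ≤belowᴳ (increasing (ℕ.s<s⁻¹ r<r′)) ⟩
      belowᴳ (index r′)  <⟨ belowᴳ<aboveᴳ (satisfies r′) ⟩
      aboveᴳ (index r′)  ∎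
      where open ≤-Reasoning poset

    chᴳ-in-chainᴳ : ∀ i → ∃[ r ] (chᴳ i ≈ chᴳ (position r))
    chᴳ-in-chainᴳ = <-weakInduction (λ i → ∃[ r ] (chᴳ i ≈ chᴳ (position r))) (zero , Eq.refl) step
      where
        step : ∀ s → ∃[ r ] (belowᴳ s ≈ chᴳ (position r)) → ∃[ r ] (aboveᴳ s ≈ chᴳ (position r))
        step s (r , bᴳ≈) with em {StrictStep s}
        ... | yes strict = let r′ , indexᵣ′≡s = complete s strict
                           in suc r′ , Eq.reflexive (≡.cong aboveᴳ (≡.sym indexᵣ′≡s))
        ... | no ¬strict = r , Eq.trans (antisym (dne ¬strict) (belowᴳ≤aboveᴳ s)) bᴳ≈

    fixed≈chᴳ : ∀ {v} → Fixed α v → (∀ i → v ≤ chᴳ i ⊎ chᴳ i ≤ v) → ∃[ i ] (v ≈ chᴳ i)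
    fixed≈chᴳ {v} v-fixed comparable with em {v ≤ chᴳ zero}
    ... | yes v≤ch₀ = zero , antisym v≤ch₀ (chᴳ-zero-minimum v)
    ... | no v≰ch₀ with crossing (λ i → v ≤ chᴳ i) v≰ch₀ (chᴳ-last-maximum v)
    ...   | s , v≰bᴳ , v≤aᴳ with comparable (inject₁ s)
    ...     | inj₁ v≤bᴳ = ⊥-elim (v≰bᴳ v≤bᴳ)
    ...     | inj₂ bᴳ≤v = suc s , antisym v≤aᴳ
                (trans (aboveᴳ≤belowᴳ∨jᴳ s) (∨-least bᴳ≤v (jᴳ-least v-fixed v≤aᴳ v≰bᴳ)))

    chainᴳ-maximal : Lᴳ.IsMaximalChain chainᴳ
    chainᴳ-maximal = chainᴳ-increasing , λ (v , v-fixed) comparable →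
      let i , v≈chᴳᵢ = fixed≈chᴳ v-fixed λ i →
            let r , chᴳᵢ≈ = chᴳ-in-chainᴳ i
            in Sum.map (≤-respʳ-≈ (Eq.sym chᴳᵢ≈)) (≤-respˡ-≈ (Eq.sym chᴳᵢ≈)) (comparable r)
          r , chᴳᵢ≈ = chᴳ-in-chainᴳ i
      in r , Eq.trans v≈chᴳᵢ chᴳᵢ≈

    fixedLattice-trim : Lᴳ.Trim
    fixedLattice-trim =
      size ,
      (chainᴳ , chainᴳ-maximal , λ r → chᴳ-leftModularᴳ (position r)) ,
      ((λ r → jᴳ (index r) , jᴳ-fixed (index r)) ,
       (λ r r′ → index-injective ∘ jᴳ-injective (satisfies r) (satisfies r′)) ,
       (λ r → jᴳ-joinIrreducible (satisfies r)) ,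
       λ v v-ji → let s , strict , v≈jᴳₛ = joinIrreducibleᴳ-entersAt {v} v-ji
                      r , indexᵣ≡s = complete s strict
                  in r , Eq.trans v≈jᴳₛ (Eq.reflexive (≡.cong jᴳ (≡.sym indexᵣ≡s)))) ,
      ((λ r → mᴳ (index r) , mᴳ-fixed (index r)) ,
       (λ r r′ → index-injective ∘ mᴳ-injective (satisfies r) (satisfies r′)) ,
       (λ r → mᴳ-meetIrreducible (satisfies r)) ,
       λ v v-mi → let s , strict , v≈mᴳₛ = meetIrreducibleᴳ-leavesAt {v} v-mi
                      r , indexᵣ≡s = complete s strict
                  in r , Eq.trans v≈mᴳₛ (Eq.reflexive (≡.cong mᴳ (≡.sym indexᵣ≡s))))

theorem4 : ExcludedMiddle 0ℓ →
    (L : Lattice 0ℓ 0ℓ 0ℓ) → LatticeNotions.FiniteTrim L →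
    (G : Group 0ℓ 0ℓ) → (α : ActionByAutomorphisms G L) →
    LatticeNotions.FiniteTrim (FixedLattice α)
theorem4 em L (fin , n , (ch , ch-maximal , ch-leftModular) , #JI , #MI) G α =
  fixedLattice-finite , fixedLattice-trim
  where
    open FiniteAction em L fin α using (fixedLattice-finite)
    open TrimLattice em L fin ch ch-maximal ch-leftModular #JI #MI
    open FixedPoints α using (fixedLattice-trim)
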